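{- $n(3)=6$; that is, the minimum number of vertices of an asymmetric $3$-graph with at least two vertices is $6$.
   Context: A $3$-graph is a pair $(X,\mathscr{M})$ with $X$ a finite set and $\mathscr{M}\subseteq\binom{X}{3}$. An automorphism is a bijection $\phi:X\to X$ with $\{\phi(M):M\in\mathscr{M}\}=\mathscr{M}$. A $3$-graph is asymmetric if its only automorphism is the identity. $n(3)$ denotes the minimum number of vertices of an asymmetric $3$-graph with at least two vertices. -}

module Defs where

open import Data.Nat using (ℕ; _≤_; _<_)
open import Data.Bool using (Bool; true)
open import Data.Fin using (Fin)
open import Data.Fin.Subset using (Subset; ∣_∣)
open import Data.Fin.Permutation using (Permutation′; _⟨$⟩ʳ_; _⟨$⟩ˡ_)
open import Data.Vec using (tabulate; lookup)
open import Data.Product using (Σ; _×_)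
open import Relation.Binary.PropositionalEquality using (_≡_)
open import Relation.Nullary using (¬_)

record ThreeGraph (n : ℕ) : Set where
  field
    edge      : Subset n → Bool
    edge-size : ∀ M → edge M ≡ true → ∣ M ∣ ≡ 3
open ThreeGraph public

image : ∀ {n} → Permutation′ n → Subset n → Subset n
image φ M = tabulate (λ j → lookup M (φ ⟨$⟩ˡ j))

-- φ is an automorphism: {φ(M) : M ∈ 𝓜} = 𝓜, i.e. M ∈ 𝓜 ⇔ φ(M) ∈ 𝓜
-- (for a bijection on subsets these are equivalent).
IsAutomorphism : ∀ {n} → ThreeGraph n → Permutation′ n → Set
IsAutomorphism G φ = ∀ M → edge G (image φ M) ≡ edge G M

Asymmetric : ∀ {n} → ThreeGraph n → Set
Asymmetric {n} G = (φ : Permutation′ n) → IsAutomorphism G φ → ∀ i → φ ⟨$⟩ʳ i ≡ i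

IsN3 : ℕ → Set
IsN3 m = (2 ≤ m × Σ (ThreeGraph m) Asymmetric)
       × (∀ k → 2 ≤ k → k < m → ¬ Σ (ThreeGraph k) Asymmetric)

-- Every family of triples on at most five points is mapped onto itself by
-- some non-identity involution of the points, whereas on six points the
-- family {013, 015, 024, 123} is mapped into itself by no self-map except
-- the identity. Both facts are settled by exhaustive computation; for n ≤ 5
-- it suffices to search the sublists of the list of all triples, since the
-- edge set of a 3-graph is one of them.
module Submission where

open import Defs
open import Data.Bool using (Bool; true; false; not; _∧_)
import Data.Bool as Bool
open import Data.Nat using (ℕ; zero; suc; _≤_; _<_; z≤n; s≤s)
import Data.Nat as ℕ
open import Data.Fin using (Fin; #_)
import Data.Fin as Fin
open import Data.Fin.Subset using (Subset; ∣_∣; ⁅_⁆; _∪_)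
open import Data.Fin.Permutation using (Permutation′; _⟨$⟩ʳ_; _⟨$⟩ˡ_; permutation; inverseˡ)
open import Data.List using (List; []; _∷_; [_]; _++_; map; filter; cartesianProductWith; allFin)
open import Data.List.Membership.Propositional using (_∈_; find)
open import Data.List.Membership.Propositional.Properties
  using (∈-cartesianProductWith⁺; ∈-filter⁺; ∈-filter⁻; ∈-allFin)
open import Data.List.Relation.Unary.All as All using (All; []; _∷_; all?)
open import Data.List.Relation.Unary.Any as Any using (Any; here; there; any?)
open import Data.List.Relation.Unary.Any.Properties using (++⁺ˡ; ++⁺ʳ; map⁺)
open import Data.Product using (Σ; _×_; _,_; proj₂)
open import Data.Vec using (Vec; []; _∷_; tabulate; lookup)
open import Data.Vec.Properties using (lookup∘tabulate; tabulate∘lookup; tabulate-cong)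
import Data.Vec.Properties as Vec
open import Function using (_∘_; id; case_of_)
open import Relation.Binary.Definitions using (DecidableEquality)
open import Relation.Binary.PropositionalEquality
  using (_≡_; _≢_; refl; sym; trans; cong; subst; module ≡-Reasoning)
open import Relation.Nullary using (¬_; ¬?; Dec; yes; no; does; contradiction)
open import Relation.Nullary.Decidable using (toWitness; _×-dec_; _→-dec_)

vectors : ∀ {A : Set} → List A → ∀ n → List (Vec A n)
vectors xs zero    = [ [] ]
vectors xs (suc n) = cartesianProductWith _∷_ xs (vectors xs n)

∈-vectors : ∀ {A : Set} {xs : List A} → (∀ x → x ∈ xs) → ∀ {n} (v : Vec A n) → v ∈ vectors xs n
∈-vectors ∈xs []      = here refl
∈-vectors ∈xs (x ∷ v) = ∈-cartesianProductWith⁺ _∷_ (∈xs x) (∈-vectors ∈xs v)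

sublists : ∀ {A : Set} → List A → List (List A)
sublists []       = [ [] ]
sublists (x ∷ xs) = sublists xs ++ map (x ∷_) (sublists xs)

module Membership {A : Set} (_≟_ : DecidableEquality A) where

  open import Data.List.Membership.DecPropositional _≟_ public using (_∈?_)

  _∈ᵇ_ : A → List A → Bool
  x ∈ᵇ xs = does (x ∈? xs)

  ∈ᵇ⇒∈ : ∀ {x xs} → x ∈ᵇ xs ≡ true → x ∈ xs
  ∈ᵇ⇒∈ {x} {xs} eq with x ∈? xs
  ... | yes x∈xs = x∈xs

  ∈⇒∈ᵇ : ∀ {x xs} → x ∈ xs → x ∈ᵇ xs ≡ true
  ∈⇒∈ᵇ {x} {xs} x∈xs with x ∈? xs
  ... | yes _   = refl
  ... | no x∉xs = contradiction x∈xs x∉xs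

  supported⇒∈ᵇ-sublists : ∀ xs (f : A → Bool) → (∀ x → f x ≡ true → x ∈ xs) →
                          Any (λ ys → ∀ x → f x ≡ x ∈ᵇ ys) (sublists xs)
  supported⇒∈ᵇ-sublists [] f supp = here absent
    where
    absent : ∀ x → f x ≡ false
    absent x with f x in fx
    ... | false = refl
    ... | true  with () ← supp x fx
  supported⇒∈ᵇ-sublists (y ∷ xs) f supp with f y in fy
  ... | false = ++⁺ˡ (supported⇒∈ᵇ-sublists xs f supp′)
    where
    supp′ : ∀ x → f x ≡ true → x ∈ xs
    supp′ x fx with supp x fx
    ... | here refl  = case trans (sym fy) fx of λ ()
    ... | there x∈xs = x∈xs
  ... | true = ++⁺ʳ (sublists xs) (map⁺ (Any.map (λ {ys} → extend {ys})
                                                 (supported⇒∈ᵇ-sublists xs f′ supp′)))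
    where
    f′ : A → Bool
    f′ x = not (does (x ≟ y)) ∧ f x
    supp′ : ∀ x → f′ x ≡ true → x ∈ xs
    supp′ x f′x with x ≟ y | supp x
    ... | no x≢y | suppₓ with suppₓ f′x
    ...   | here x≡y   = contradiction x≡y x≢y
    ...   | there x∈xs = x∈xs
    extend : ∀ {ys} → (∀ x → f′ x ≡ x ∈ᵇ ys) → ∀ x → f x ≡ x ∈ᵇ (y ∷ ys)
    extend agree x with x ≟ y | agree x
    ... | yes refl | _    = fy
    ... | no _     | f′x≡ = f′x≡

open module SubsetMembership {n} = Membership {Subset n} (Vec.≡-dec Bool._≟_)
  using (_∈?_; _∈ᵇ_; ∈ᵇ⇒∈; ∈⇒∈ᵇ; supported⇒∈ᵇ-sublists)

subsets : ∀ n → List (Subset n)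
subsets = vectors (false ∷ true ∷ [])

∈-subsets : ∀ {n} (M : Subset n) → M ∈ subsets n
∈-subsets = ∈-vectors λ { false → here refl ; true → there (here refl) }

triples : ∀ n → List (Subset n)
triples n = filter (λ M → ∣ M ∣ ℕ.≟ 3) (subsets n)

edge⇒∈-triples : ∀ {n} (G : ThreeGraph n) M → edge G M ≡ true → M ∈ triples n
edge⇒∈-triples G M eq = ∈-filter⁺ (λ M → ∣ M ∣ ℕ.≟ 3) (∈-subsets M) (edge-size G M eq)

preimage : ∀ {n} → (Fin n → Fin n) → Subset n → Subset n
preimage f M = tabulate (lookup M ∘ f)

preimage-∘ : ∀ {n} (f g : Fin n → Fin n) M → preimage g (preimage f M) ≡ preimage (f ∘ g) M
preimage-∘ f g M = tabulate-cong (λ j → lookup∘tabulate (lookup M ∘ f) (g j))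

preimage-id : ∀ {n} (M : Subset n) → preimage id M ≡ M
preimage-id = tabulate∘lookup

Involutive : ∀ {n} → Vec (Fin n) n → Set
Involutive {n} τ = All (λ i → lookup τ (lookup τ i) ≡ i) (allFin n)

involutive? : ∀ {n} (τ : Vec (Fin n) n) → Dec (Involutive τ)
involutive? τ = all? (λ i → lookup τ (lookup τ i) Fin.≟ i) (allFin _)

involutions : ∀ n → List (Vec (Fin n) n)
involutions n = filter involutive? (vectors (allFin n) n)

involution : ∀ {n} (τ : Vec (Fin n) n) → Involutive τ → Permutation′ n
involution τ inv = permutation (lookup τ) (lookup τ) τ²≡id τ²≡id
  where τ²≡id = λ i → All.lookup inv (∈-allFin i)

preimage-involutive : ∀ {n} (τ : Vec (Fin n) n) → Involutive τ →
                      ∀ M → preimage (lookup τ) (preimage (lookup τ) M) ≡ M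
preimage-involutive τ inv M = begin
  preimage (lookup τ) (preimage (lookup τ) M) ≡⟨ preimage-∘ (lookup τ) (lookup τ) M ⟩
  preimage (lookup τ ∘ lookup τ) M            ≡⟨ tabulate-cong (cong (lookup M) ∘ τ²≡id) ⟩
  preimage id M                               ≡⟨ preimage-id M ⟩
  M                                           ∎
  where
  open ≡-Reasoning
  τ²≡id = λ j → All.lookup inv (∈-allFin j)

closed⇒invariant : ∀ {n} (τ : Vec (Fin n) n) {E : List (Subset n)} → Involutive τ →
                   All (λ M → preimage (lookup τ) M ∈ E) E →
                   ∀ M → preimage (lookup τ) M ∈ᵇ E ≡ M ∈ᵇ E
closed⇒invariant τ {E} inv closed M with preimage (lookup τ) M ∈? E | M ∈? E
... | yes _    | yes _   = refl
... | no _     | no _    = refl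
... | no τM∉E  | yes M∈E = contradiction (All.lookup closed M∈E) τM∉E
... | yes τM∈E | no M∉E  =
  contradiction (subst (_∈ E) (preimage-involutive τ inv M) (All.lookup closed τM∈E)) M∉E

Symmetry : ∀ {n} → List (Subset n) → Vec (Fin n) n → Set
Symmetry {n} E τ =
  Any (λ i → lookup τ i ≢ i) (allFin n) × All (λ M → preimage (lookup τ) M ∈ E) E

symmetry? : ∀ {n} (E : List (Subset n)) τ → Dec (Symmetry E τ)
symmetry? E τ = any? (λ i → ¬? (lookup τ i Fin.≟ i)) (allFin _)
                ×-dec all? (λ M → preimage (lookup τ) M ∈? E) E

-- The candidates are an argument so that the list is computed once, not once per family.
allHaveSymmetryIn? : ∀ {n} (candidates : List (Vec (Fin n) n)) (Es : List (List (Subset n))) →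
                     Dec (All (λ E → Any (Symmetry E) candidates) Es)
allHaveSymmetryIn? candidates = all? (λ E → any? (symmetry? E) candidates)

EveryFamilySymmetric : ℕ → Set
EveryFamilySymmetric n = All (λ E → Any (Symmetry E) (involutions n)) (sublists (triples n))

everyFamilySymmetric? : ∀ n → Dec (EveryFamilySymmetric n)
everyFamilySymmetric? n = allHaveSymmetryIn? (involutions n) (sublists (triples n))

everyFamilySymmetric⇒¬asymmetric : ∀ {n} → EveryFamilySymmetric n → ¬ Σ (ThreeGraph n) Asymmetric
everyFamilySymmetric⇒¬asymmetric {n} every (G , asymmetric)
  with supported⇒∈ᵇ-sublists (triples n) (edge G) (edge⇒∈-triples G)
... | family with All.lookupAny every family
...   | symmetric , agree with find symmetric
...     | τ , τ∈involutions , moves , closed with Any.satisfied moves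
...       | i , τi≢i = τi≢i (asymmetric (involution τ inv) automorphism i)
  where
  E = Any.lookup family
  inv : Involutive τ
  inv = proj₂ (∈-filter⁻ involutive? {xs = vectors (allFin n) n} τ∈involutions)
  automorphism : IsAutomorphism G (involution τ inv)
  automorphism M = begin
    edge G (preimage (lookup τ) M) ≡⟨ agree (preimage (lookup τ) M) ⟩
    preimage (lookup τ) M ∈ᵇ E     ≡⟨ closed⇒invariant τ inv closed M ⟩
    M ∈ᵇ E                         ≡⟨ agree M ⟨
    edge G M                       ∎
    where open ≡-Reasoning

fromEdges : ∀ {n} (E : List (Subset n)) → All (λ M → ∣ M ∣ ≡ 3) E → ThreeGraph n
fromEdges E sizes = record
  { edge      = _∈ᵇ E
  ; edge-size = λ M M∈ᵇE → All.lookup sizes (∈ᵇ⇒∈ M∈ᵇE)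
  }

-- Self-maps of Fin n, tabulated, are cheaper to enumerate than permutations;
-- the inverse of an automorphism is one of them.
OnlyIdentityPreserves : ∀ {n} → List (Subset n) → Set
OnlyIdentityPreserves {n} E =
  All (λ t → All (λ M → preimage (lookup t) M ∈ E) E → t ≡ tabulate id) (vectors (allFin n) n)

onlyIdentityPreserves? : ∀ {n} (E : List (Subset n)) → Dec (OnlyIdentityPreserves E)
onlyIdentityPreserves? E =
  all? (λ t → all? (λ M → preimage (lookup t) M ∈? E) E →-dec Vec.≡-dec Fin._≟_ t (tabulate id))
       (vectors (allFin _) _)

onlyIdentityPreserves⇒asymmetric : ∀ {n} (E : List (Subset n)) (sizes : All (λ M → ∣ M ∣ ≡ 3) E) →
                                   OnlyIdentityPreserves E → Asymmetric (fromEdges E sizes)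
onlyIdentityPreserves⇒asymmetric {n} E sizes rigid φ automorphism i =
  trans (sym (φ⁻¹-fixes (φ ⟨$⟩ʳ i))) (inverseˡ φ)
  where
  t : Vec (Fin n) n
  t = tabulate (φ ⟨$⟩ˡ_)
  preimage-t : ∀ M → preimage (lookup t) M ≡ image φ M
  preimage-t M = tabulate-cong (λ j → cong (lookup M) (lookup∘tabulate (φ ⟨$⟩ˡ_) j))
  t≡id : t ≡ tabulate id
  t≡id = All.lookup rigid (∈-vectors ∈-allFin t) (All.tabulate λ {M} M∈E →
           subst (_∈ E) (sym (preimage-t M)) (∈ᵇ⇒∈ (trans (automorphism M) (∈⇒∈ᵇ M∈E))))
  φ⁻¹-fixes : ∀ j → φ ⟨$⟩ˡ j ≡ j
  φ⁻¹-fixes j = begin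
    φ ⟨$⟩ˡ j               ≡⟨ lookup∘tabulate (φ ⟨$⟩ˡ_) j ⟨
    lookup t j             ≡⟨ cong (λ u → lookup u j) t≡id ⟩
    lookup (tabulate id) j ≡⟨ lookup∘tabulate id j ⟩
    j                      ∎
    where open ≡-Reasoning

triple : ∀ {n} → Fin n → Fin n → Fin n → Subset n
triple i j k = ⁅ i ⁆ ∪ ⁅ j ⁆ ∪ ⁅ k ⁆

E₆ : List (Subset 6)
E₆ = triple (# 0) (# 1) (# 3) ∷ triple (# 0) (# 1) (# 5)
   ∷ triple (# 0) (# 2) (# 4) ∷ triple (# 1) (# 2) (# 3) ∷ []

E₆-sizes : All (λ M → ∣ M ∣ ≡ 3) E₆
E₆-sizes = refl ∷ refl ∷ refl ∷ refl ∷ []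

G₆ : ThreeGraph 6
G₆ = fromEdges E₆ E₆-sizes

G₆-asymmetric : Asymmetric G₆
G₆-asymmetric =
  onlyIdentityPreserves⇒asymmetric E₆ E₆-sizes (toWitness {a? = onlyIdentityPreserves? E₆} _)

lemma8 : IsN3 6
lemma8 = (s≤s (s≤s z≤n) , G₆ , G₆-asymmetric) , λ k 2≤k k<6 →
  everyFamilySymmetric⇒¬asymmetric (everyFamilySymmetric k 2≤k k<6)
  where
  everyFamilySymmetric : ∀ k → 2 ≤ k → k < 6 → EveryFamilySymmetric k
  everyFamilySymmetric 0 () _
  everyFamilySymmetric 1 (s≤s ()) _
  everyFamilySymmetric 2 _ _ = toWitness {a? = everyFamilySymmetric? 2} _
  everyFamilySymmetric 3 _ _ = toWitness {a? = everyFamilySymmetric? 3} _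
  everyFamilySymmetric 4 _ _ = toWitness {a? = everyFamilySymmetric? 4} _
  everyFamilySymmetric 5 _ _ = toWitness {a? = everyFamilySymmetric? 5} _
  everyFamilySymmetric (suc (suc (suc (suc (suc (suc _)))))) _
    (s≤s (s≤s (s≤s (s≤s (s≤s (s≤s ()))))))
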